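{- Let $n,t,s$ be integers with $n/2-t$ a nonnegative integer, and let $m$ be an integer with $n\ge m>4(s+t)^2$ such that a Hadamard matrix of size $m$ exists. Then \[ \chi_F\left[K\left(n,\tfrac n2-t,s\right)\right]\le 2m. \]
   Context: $K(n,k,s)$ is the graph on $\binom{[n]}{k}$ in which two $k$-subsets of $[n]=\{1,\dots,n\}$ are adjacent iff they share fewer than $s$ elements. For $A\subseteq[n]$, the Frankl set is $I_A=\{v\in\binom{[n]}{k}: |v\cap A|\ge (|A|+s)/2\}$. The F-chromatic number $\chi_F[K(n,k,s)]$ is the minimum number of colors in a proper coloring in which every color class is contained in some Frankl set. A Hadamard matrix of size $m$ is an $m\times m$ matrix with entries $\pm1$ whose rows are mutually orthogonal. -}

module Defs where

open import Data.Nat using (ℕ; zero; suc)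
import Data.Nat as ℕ
open import Data.Integer using (ℤ; +_; _+_; _*_; _≤_; _<_; -_; -1ℤ; 0ℤ; 1ℤ)
open import Data.Fin using (Fin; zero; suc)
open import Data.Fin.Subset using (Subset; _∩_; ∣_∣)
open import Data.Product using (Σ; Σ-syntax; ∃; ∃-syntax; _×_; proj₁)
open import Data.Sum using (_⊎_)
open import Relation.Binary.PropositionalEquality using (_≡_; _≢_)

sumFin : {m : ℕ} → (Fin m → ℤ) → ℤ
sumFin {zero}  f = 0ℤ
sumFin {suc m} f = f zero + sumFin (λ i → f (suc i))

IsHadamard : (m : ℕ) → (Fin m → Fin m → ℤ) → Set
IsHadamard m H =
  (∀ i j → H i j ≡ 1ℤ ⊎ H i j ≡ -1ℤ) ×
  (∀ i j → i ≢ j → sumFin (λ l → H i l * H j l) ≡ 0ℤ)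

HadamardExists : ℕ → Set
HadamardExists m = Σ (Fin m → Fin m → ℤ) (IsHadamard m)

Vertex : ℕ → ℕ → Set
Vertex n k = Σ (Subset n) (λ v → ∣ v ∣ ≡ k)

Adjacent : {n k : ℕ} → ℤ → Vertex n k → Vertex n k → Set
Adjacent s v w = + ∣ proj₁ v ∩ proj₁ w ∣ < s

InFrankl : {n k : ℕ} → ℤ → Subset n → Vertex n k → Set
InFrankl s A v = + ∣ A ∣ + s ≤ + (2 ℕ.* ∣ proj₁ v ∩ A ∣)

FColoring : (n k : ℕ) → ℤ → ℕ → Set
FColoring n k s c =
  Σ[ col ∈ (Vertex n k → Fin c) ]
    ((∀ v w → Adjacent s v w → col v ≢ col w) ×
     (∀ (i : Fin c) → ∃[ A ] (∀ v → col v ≡ i → InFrankl s A v)))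

χF≤ : (n k : ℕ) → ℤ → ℕ → Set
χF≤ n k s c = FColoring n k s c

-- Encode a vertex v by its ±1 vector y.  For a set A with ±1 vector a,
-- ⟨a, y⟩ + 2|A| + 2k = 4|v ∩ A| + n, so when n = 2k + 2t the vertex lies in
-- the Frankl set I_A as soon as ⟨a, y⟩ ≥ 2(s + t).  Fold [n] onto [m] by
-- sending every coordinate ≥ m − 1 to the last one; the folded vector Y has
-- ‖Y‖² ≥ m − 1, its first m − 1 entries being ±1.  As HHᵀ = mI, the columns
-- H_l satisfy Σ_l ⟨H_l, Y⟩² = m‖Y‖² ≥ m(m − 1) ≥ m · 4(s + t)², so some
-- |⟨H_l, Y⟩| ≥ 2(s + t); and ⟨H_l, Y⟩ is the inner product of y with H_l
-- pulled back along the fold.  So the 2m sets whose ±1 vectors are ± these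
-- pullbacks cover every vertex by a Frankl set, and each is a colour class,
-- since a Frankl set is independent: u, w ∈ I_A gives
-- |u ∩ w| ≥ |u ∩ A| + |w ∩ A| − |A| ≥ s.

module Submission where

open import Defs
open import Data.Bool using (Bool; true; false; if_then_else_; _∧_)
open import Data.Empty using (⊥-elim)
open import Data.Fin as Fin using (Fin; zero; suc; toℕ)
import Data.Fin.Properties as FinP
open import Data.Fin.Subset using (Subset; _∩_) renaming (∣_∣ to ∣_∣ₛ)
open import Data.Integer as ℤ
  using (ℤ; +_; -[1+_]; _+_; _-_; _*_; -_; ∣_∣; _<_; _≤_; +≤+; -≤+; 0ℤ; 1ℤ; -1ℤ)
import Data.Integer.Properties as ℤP
open import Data.Integer.Tactic.RingSolver using (solve-∀)
open import Data.Nat using (ℕ; zero; suc)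
import Data.Nat as ℕ
import Data.Nat.Properties as ℕP
open import Data.Product using (∃; _,_; proj₁; proj₂; uncurry)
open import Data.Sum as Sum using (_⊎_; inj₁; inj₂)
open import Data.Vec using ([]; _∷_; lookup; tabulate)
import Data.Vec.Properties as VecP
open import Relation.Nullary using (does; yes; no; ¬_)
open import Relation.Binary.PropositionalEquality
  using (_≡_; _≢_; refl; sym; trans; cong; cong₂; subst; subst₂; module ≡-Reasoning)
open import Algebra.Properties.Semiring.Sum ℤP.+-*-semiring
  using (sum; sum-syntax; sum-cong-≗; ∑-distrib-+; ∑-comm; *-distribˡ-sum; *-distribʳ-sum; sum-init-last)

sumFin≡∑ : ∀ {m} (f : Fin m → ℤ) → sumFin f ≡ ∑[ i < m ] f i
sumFin≡∑ {zero}  f = refl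
sumFin≡∑ {suc m} f = cong (_+_ (f zero)) (sumFin≡∑ (λ i → f (suc i)))

∑-const : ∀ m (c : ℤ) → ∑[ i < m ] c ≡ + m * c
∑-const zero    c = sym (ℤP.*-zeroˡ c)
∑-const (suc m) c = begin
  c + ∑[ i < m ] c  ≡⟨ cong (_+_ c) (∑-const m c) ⟩
  c + + m * c       ≡⟨ sym (ℤP.suc-* (+ m) c) ⟩
  + suc m * c       ∎
  where open ≡-Reasoning

∑-mono-≤ : ∀ {m} {f g : Fin m → ℤ} → (∀ i → f i ≤ g i) → ∑[ i < m ] f i ≤ ∑[ i < m ] g i
∑-mono-≤ {zero}  f≤g = ℤP.≤-refl
∑-mono-≤ {suc m} f≤g = ℤP.+-mono-≤ (f≤g zero) (∑-mono-≤ (λ i → f≤g (suc i)))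

∑-mono-< : ∀ {m} {f g : Fin (suc m) → ℤ} → (∀ i → f i < g i) →
           ∑[ i < suc m ] f i < ∑[ i < suc m ] g i
∑-mono-< f<g = ℤP.+-mono-<-≤ (f<g zero) (∑-mono-≤ (λ i → ℤP.<⇒≤ (f<g (suc i))))

∑-*-∑ : ∀ {m p} (f : Fin m → ℤ) (g : Fin p → ℤ) →
        (∑[ i < m ] f i) * (∑[ j < p ] g j) ≡ ∑[ i < m ] ∑[ j < p ] (f i * g j)
∑-*-∑ {m} {p} f g = begin
  (∑[ i < m ] f i) * (∑[ j < p ] g j)    ≡⟨ *-distribʳ-sum _ f ⟩
  ∑[ i < m ] (f i * ∑[ j < p ] g j)      ≡⟨ sum-cong-≗ (λ i → *-distribˡ-sum (f i) g) ⟩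
  ∑[ i < m ] ∑[ j < p ] (f i * g j)        ∎
  where open ≡-Reasoning

δ : ∀ {m} → Fin m → Fin m → ℤ
δ i j = if does (i FinP.≟ j) then 1ℤ else 0ℤ

∑-δ : ∀ {m} (i : Fin m) (f : Fin m → ℤ) → ∑[ j < m ] (δ i j * f j) ≡ f i
∑-δ {suc m} zero f = begin
  1ℤ * f zero + ∑[ j < m ] (0ℤ * f (suc j))  ≡⟨ cong₂ _+_ (ℤP.*-identityˡ (f zero)) ∑0 ⟩
  f zero + 0ℤ                               ≡⟨ ℤP.+-identityʳ (f zero) ⟩
  f zero                                    ∎
  where
  open ≡-Reasoning
  ∑0 : ∑[ j < m ] (0ℤ * f (suc j)) ≡ 0ℤ
  ∑0 = trans (∑-const m 0ℤ) (ℤP.*-zeroʳ (+ m))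
∑-δ {suc m} (suc i) f = trans (ℤP.+-identityˡ _) (∑-δ i (λ j → f (suc j)))

δ-resp-⇔ : ∀ {m p} {a b : Fin m} {c d : Fin p} →
           (a ≡ b → c ≡ d) → (c ≡ d → a ≡ b) → δ a b ≡ δ c d
δ-resp-⇔ {a = a} {b} {c} {d} to from with a FinP.≟ b | c FinP.≟ d
... | yes _   | yes _   = refl
... | no  _   | no  _   = refl
... | yes a≡b | no  c≢d = ⊥-elim (c≢d (to a≡b))
... | no  a≢b | yes c≡d = ⊥-elim (a≢b (from c≡d))

module _ {m n} (β : Fin n → Fin m) where

  fibreSum : (Fin n → ℤ) → Fin m → ℤ
  fibreSum y b = ∑[ j < n ] (δ (β j) b * y j)

  ∑-*-fibreSum : (f : Fin m → ℤ) (y : Fin n → ℤ) →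
                 ∑[ b < m ] (f b * fibreSum y b) ≡ ∑[ j < n ] (f (β j) * y j)
  ∑-*-fibreSum f y = begin
    ∑[ b < m ] (f b * fibreSum y b)
      ≡⟨ sum-cong-≗ (λ b → *-distribˡ-sum (f b) (λ j → δ (β j) b * y j)) ⟩
    ∑[ b < m ] ∑[ j < n ] (f b * (δ (β j) b * y j))
      ≡⟨ ∑-comm (λ b j → f b * (δ (β j) b * y j)) ⟩
    ∑[ j < n ] ∑[ b < m ] (f b * (δ (β j) b * y j))
      ≡⟨ sum-cong-≗ (λ j → sum-cong-≗ (λ b → regroup (f b) (δ (β j) b) (y j))) ⟩
    ∑[ j < n ] ∑[ b < m ] (δ (β j) b * (f b * y j))
      ≡⟨ sum-cong-≗ (λ j → ∑-δ (β j) (λ b → f b * y j)) ⟩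
    ∑[ j < n ] (f (β j) * y j) ∎
    where
    open ≡-Reasoning
    regroup : ∀ x d y → x * (d * y) ≡ d * (x * y)
    regroup = solve-∀

  fibreSum-singleton : ∀ {i b} → β i ≡ b → (∀ j → β j ≡ b → i ≡ j) →
                       (y : Fin n → ℤ) → fibreSum y b ≡ y i
  fibreSum-singleton {i} {b} βi≡b fibre⊆i y = trans (sum-cong-≗ δ-fibre) (∑-δ i y)
    where
    δ-fibre : ∀ j → δ (β j) b * y j ≡ δ i j * y j
    δ-fibre j = cong (_* y j) (δ-resp-⇔ (fibre⊆i j) (λ i≡j → trans (cong β (sym i≡j)) βi≡b))

IsSign : ℤ → Set
IsSign x = x ≡ 1ℤ ⊎ x ≡ -1ℤ

IsSign⇒i*i≡1 : ∀ {x} → IsSign x → x * x ≡ 1ℤ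
IsSign⇒i*i≡1 (inj₁ refl) = refl
IsSign⇒i*i≡1 (inj₂ refl) = refl

IsSign-* : ∀ {x y} → IsSign x → IsSign y → IsSign (x * y)
IsSign-* (inj₁ refl) (inj₁ refl) = inj₁ refl
IsSign-* (inj₁ refl) (inj₂ refl) = inj₂ refl
IsSign-* (inj₂ refl) (inj₁ refl) = inj₂ refl
IsSign-* (inj₂ refl) (inj₂ refl) = inj₁ refl

averaging : ∀ {m} (f : Fin (suc m) → ℤ) (q : ℤ) →
            + suc m * q ≤ ∑[ i < suc m ] f i → ∃ λ i → q ≤ f i
averaging {m} f q mq≤∑f with FinP.any? (λ i → q ℤP.≤? f i)
... | yes found = found
... | no none = ⊥-elim (ℤP.<⇒≱ ∑f<mq mq≤∑f)
  where
  ∑f<mq : ∑[ i < suc m ] f i < + suc m * q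
  ∑f<mq = ℤP.<-≤-trans (∑-mono-< (λ i → ℤP.≰⇒> (λ q≤fi → none (i , q≤fi))))
                       (ℤP.≤-reflexive (∑-const (suc m) q))

i*i≡+∣i∣*∣i∣ : ∀ i → i * i ≡ + (∣ i ∣ ℕ.* ∣ i ∣)
i*i≡+∣i∣*∣i∣ (+ p)    = sym (ℤP.pos-* p p)
i*i≡+∣i∣*∣i∣ -[1+ p ] = refl

0≤i*i : ∀ i → 0ℤ ≤ i * i
0≤i*i i = ℤP.≤-trans (+≤+ ℕ.z≤n) (ℤP.≤-reflexive (sym (i*i≡+∣i∣*∣i∣ i)))

i≤+∣i∣ : ∀ i → i ≤ + ∣ i ∣
i≤+∣i∣ (+ p)    = ℤP.≤-refl
i≤+∣i∣ -[1+ p ] = -≤+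

m*m≤n*n⇒m≤n : ∀ {m n} → m ℕ.* m ℕ.≤ n ℕ.* n → m ℕ.≤ n
m*m≤n*n⇒m≤n {m} {n} m²≤n² with m ℕP.≤? n
... | yes m≤n = m≤n
... | no m≰n  = let n<m = ℕP.≰⇒> m≰n in ⊥-elim (ℕP.<⇒≱ (ℕP.*-mono-< n<m n<m) m²≤n²)

i*i≤j*j⇒i≤j⊎i≤-j : ∀ i j → i * i ≤ j * j → i ≤ j ⊎ i ≤ - j
i*i≤j*j⇒i≤j⊎i≤-j i j i²≤j² =
  Sum.map (λ ∣j∣≡j → subst (i ≤_) ∣j∣≡j i≤∣j∣) (λ ∣j∣≡-j → subst (i ≤_) ∣j∣≡-j i≤∣j∣)
          (ℤP.+∣i∣≡i⊎+∣i∣≡-i j)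
  where
  i≤∣j∣ : i ≤ + ∣ j ∣
  i≤∣j∣ = ℤP.≤-trans (i≤+∣i∣ i) (+≤+ (m*m≤n*n⇒m≤n (ℤP.drop‿+≤+
    (subst₂ _≤_ (i*i≡+∣i∣*∣i∣ i) (i*i≡+∣i∣*∣i∣ j) i²≤j²))))

4[i*i]≡[2i]*[2i] : ∀ i → + 4 * (i * i) ≡ + 2 * i * (+ 2 * i)
4[i*i]≡[2i]*[2i] = solve-∀

+-cancelʳ-≤ : ∀ {i j} k → i + k ≤ j + k → i ≤ j
+-cancelʳ-≤ {i} {j} k i+k≤j+k =
  ℤP.0≤i-j⇒j≤i (subst (0ℤ ≤_) (cancel i j k) (ℤP.i≤j⇒0≤j-i i+k≤j+k))
  where
  cancel : ∀ i j k → (j + k) - (i + k) ≡ j - i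
  cancel = solve-∀

+[2*m]≡+m++m : ∀ m → + (2 ℕ.* m) ≡ + m + + m
+[2*m]≡+m++m m = trans (cong +_ (cong (m ℕ.+_) (ℕP.+-identityʳ m))) (ℤP.pos-+ m m)

_ᵀ*_ : ∀ {m p} → (Fin m → Fin p → ℤ) → (Fin m → ℤ) → Fin p → ℤ
(H ᵀ* y) l = ∑[ b < _ ] (H b l * y b)

module _ {m} {H : Fin m → Fin m → ℤ} (isH : IsHadamard m H) where

  ∑-row-*-row : ∀ b c → ∑[ l < m ] (H b l * H c l) ≡ + m * δ b c
  ∑-row-*-row b c with b FinP.≟ c
  ... | yes refl = begin
    ∑[ l < m ] (H b l * H b l)  ≡⟨ sum-cong-≗ (λ l → IsSign⇒i*i≡1 (proj₁ isH b l)) ⟩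
    ∑[ l < m ] 1ℤ               ≡⟨ ∑-const m 1ℤ ⟩
    + m * 1ℤ                    ∎
    where open ≡-Reasoning
  ... | no b≢c = begin
    ∑[ l < m ] (H b l * H c l)  ≡⟨ sym (sumFin≡∑ (λ l → H b l * H c l)) ⟩
    sumFin (λ l → H b l * H c l) ≡⟨ proj₂ isH b c b≢c ⟩
    0ℤ                          ≡⟨ sym (ℤP.*-zeroʳ (+ m)) ⟩
    + m * 0ℤ                    ∎
    where open ≡-Reasoning

  parseval : ∀ y → ∑[ l < m ] ((H ᵀ* y) l * (H ᵀ* y) l) ≡ + m * ∑[ b < m ] (y b * y b)
  parseval y = begin
    ∑[ l < m ] ((H ᵀ* y) l * (H ᵀ* y) l)
      ≡⟨ sum-cong-≗ (λ l → ∑-*-∑ (λ b → H b l * y b) (λ c → H c l * y c)) ⟩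
    ∑[ l < m ] ∑[ b < m ] ∑[ c < m ] (H b l * y b * (H c l * y c))
      ≡⟨ ∑-comm (λ l b → ∑[ c < m ] (H b l * y b * (H c l * y c))) ⟩
    ∑[ b < m ] ∑[ l < m ] ∑[ c < m ] (H b l * y b * (H c l * y c))
      ≡⟨ sum-cong-≗ (λ b → ∑-comm (λ l c → H b l * y b * (H c l * y c))) ⟩
    ∑[ b < m ] ∑[ c < m ] ∑[ l < m ] (H b l * y b * (H c l * y c))
      ≡⟨ sum-cong-≗ (λ b → sum-cong-≗ (λ c → gram-term b c)) ⟩
    ∑[ b < m ] ∑[ c < m ] (δ b c * (+ m * (y b * y c)))
      ≡⟨ sum-cong-≗ (λ b → ∑-δ b (λ c → + m * (y b * y c))) ⟩
    ∑[ b < m ] (+ m * (y b * y b))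
      ≡⟨ sym (*-distribˡ-sum (+ m) (λ b → y b * y b)) ⟩
    + m * ∑[ b < m ] (y b * y b) ∎
    where
    open ≡-Reasoning
    gram-term : ∀ b c → ∑[ l < m ] (H b l * y b * (H c l * y c)) ≡ δ b c * (+ m * (y b * y c))
    gram-term b c = begin
      ∑[ l < m ] (H b l * y b * (H c l * y c))  ≡⟨ sum-cong-≗ (λ l → regroup (H b l) (y b) (H c l) (y c)) ⟩
      ∑[ l < m ] (y b * y c * (H b l * H c l))  ≡⟨ sym (*-distribˡ-sum (y b * y c) (λ l → H b l * H c l)) ⟩
      y b * y c * ∑[ l < m ] (H b l * H c l)    ≡⟨ cong (y b * y c *_) (∑-row-*-row b c) ⟩
      y b * y c * (+ m * δ b c)                 ≡⟨ regroup′ (y b * y c) (+ m) (δ b c) ⟩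
      δ b c * (+ m * (y b * y c))               ∎
      where
      regroup : ∀ h x h′ x′ → h * x * (h′ * x′) ≡ x * x′ * (h * h′)
      regroup = solve-∀
      regroup′ : ∀ a k d → a * (k * d) ≡ d * (k * a)
      regroup′ = solve-∀

indicator : Bool → ℤ
indicator true  = 1ℤ
indicator false = 0ℤ

signed : Bool → ℤ
signed true  = 1ℤ
signed false = -1ℤ

signed-IsSign : ∀ b → IsSign (signed b)
signed-IsSign true  = inj₁ refl
signed-IsSign false = inj₂ refl

signs : ∀ {n} → Subset n → Fin n → ℤ
signs p j = signed (lookup p j)

+∣p∣≡∑indicator : ∀ {n} (p : Subset n) → + ∣ p ∣ₛ ≡ ∑[ j < n ] indicator (lookup p j)
+∣p∣≡∑indicator []          = refl
+∣p∣≡∑indicator (true ∷ p)  = cong (_+_ 1ℤ) (+∣p∣≡∑indicator p)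
+∣p∣≡∑indicator (false ∷ p) = trans (+∣p∣≡∑indicator p) (sym (ℤP.+-identityˡ _))

+∣p∩q∣≡∑indicator : ∀ {n} (p q : Subset n) →
                    + ∣ p ∩ q ∣ₛ ≡ ∑[ j < n ] indicator (lookup p j ∧ lookup q j)
+∣p∩q∣≡∑indicator p q =
  trans (+∣p∣≡∑indicator (p ∩ q)) (sum-cong-≗ (λ j → cong indicator (VecP.lookup-zipWith _∧_ j p q)))

∣p∩r∣+∣q∩r∣≤∣p∩q∣+∣r∣ : ∀ {n} (p q r : Subset n) →
                        + ∣ p ∩ r ∣ₛ + + ∣ q ∩ r ∣ₛ ≤ + ∣ p ∩ q ∣ₛ + + ∣ r ∣ₛ
∣p∩r∣+∣q∩r∣≤∣p∩q∣+∣r∣ {n} p q r = begin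
  + ∣ p ∩ r ∣ₛ + + ∣ q ∩ r ∣ₛ  ≡⟨ cong₂ _+_ (+∣p∩q∣≡∑indicator p r) (+∣p∩q∣≡∑indicator q r) ⟩
  sum pr + sum qr            ≡⟨ sym (∑-distrib-+ pr qr) ⟩
  ∑[ j < n ] (pr j + qr j)   ≤⟨ ∑-mono-≤ (λ j → pointwise (lookup p j) (lookup q j) (lookup r j)) ⟩
  ∑[ j < n ] (pq j + rr j)   ≡⟨ ∑-distrib-+ pq rr ⟩
  sum pq + sum rr            ≡⟨ sym (cong₂ _+_ (+∣p∩q∣≡∑indicator p q) (+∣p∣≡∑indicator r)) ⟩
  + ∣ p ∩ q ∣ₛ + + ∣ r ∣ₛ      ∎
  where
  open ℤP.≤-Reasoning
  pr qr pq rr : Fin n → ℤ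
  pr j = indicator (lookup p j ∧ lookup r j)
  qr j = indicator (lookup q j ∧ lookup r j)
  pq j = indicator (lookup p j ∧ lookup q j)
  rr j = indicator (lookup r j)
  pointwise : ∀ x y z → indicator (x ∧ z) + indicator (y ∧ z) ≤ indicator (x ∧ y) + indicator z
  pointwise true  true  true  = ℤP.≤-refl
  pointwise true  true  false = +≤+ ℕ.z≤n
  pointwise true  false true  = ℤP.≤-refl
  pointwise true  false false = ℤP.≤-refl
  pointwise false true  true  = ℤP.≤-refl
  pointwise false true  false = ℤP.≤-refl
  pointwise false false true  = +≤+ ℕ.z≤n
  pointwise false false false = ℤP.≤-refl

correlation : ∀ {n} → Subset n → Subset n → ℤ
correlation {n} p q = ∑[ j < n ] (signs p j * signs q j)

correlation-+-cards : ∀ {n} (p q : Subset n) →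
  correlation p q + (+ 2 * + ∣ p ∣ₛ + + 2 * + ∣ q ∣ₛ) ≡ + 4 * + ∣ q ∩ p ∣ₛ + + n
correlation-+-cards {n} p q = begin
  correlation p q + (+ 2 * + ∣ p ∣ₛ + + 2 * + ∣ q ∣ₛ)
    ≡⟨ cong (λ z → correlation p q + z) (cong₂ _+_
         (trans (cong (+ 2 *_) (+∣p∣≡∑indicator p)) (*-distribˡ-sum (+ 2) a))
         (trans (cong (+ 2 *_) (+∣p∣≡∑indicator q)) (*-distribˡ-sum (+ 2) x))) ⟩
  correlation p q + (∑[ j < n ] (+ 2 * a j) + ∑[ j < n ] (+ 2 * x j))
    ≡⟨ cong (λ z → correlation p q + z) (sym (∑-distrib-+ (λ j → + 2 * a j) (λ j → + 2 * x j))) ⟩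
  correlation p q + ∑[ j < n ] (+ 2 * a j + + 2 * x j)
    ≡⟨ sym (∑-distrib-+ (λ j → signs p j * signs q j) (λ j → + 2 * a j + + 2 * x j)) ⟩
  ∑[ j < n ] (signs p j * signs q j + (+ 2 * a j + + 2 * x j))
    ≡⟨ sum-cong-≗ (λ j → pointwise (lookup p j) (lookup q j)) ⟩
  ∑[ j < n ] (+ 4 * x∧a j + 1ℤ)
    ≡⟨ ∑-distrib-+ (λ j → + 4 * x∧a j) (λ _ → 1ℤ) ⟩
  ∑[ j < n ] (+ 4 * x∧a j) + ∑[ j < n ] 1ℤ
    ≡⟨ cong₂ _+_ (sym (*-distribˡ-sum (+ 4) x∧a)) (trans (∑-const n 1ℤ) (ℤP.*-identityʳ (+ n))) ⟩
  + 4 * sum x∧a + + n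
    ≡⟨ cong (λ z → + 4 * z + + n) (sym (+∣p∩q∣≡∑indicator q p)) ⟩
  + 4 * + ∣ q ∩ p ∣ₛ + + n ∎
  where
  open ≡-Reasoning
  a x x∧a : Fin n → ℤ
  a j = indicator (lookup p j)
  x j = indicator (lookup q j)
  x∧a j = indicator (lookup q j ∧ lookup p j)
  pointwise : ∀ α ξ → signed α * signed ξ + (+ 2 * indicator α + + 2 * indicator ξ)
                      ≡ + 4 * indicator (ξ ∧ α) + 1ℤ
  pointwise true  true  = refl
  pointwise true  false = refl
  pointwise false true  = refl
  pointwise false false = refl

positives : ∀ {n} → (Fin n → ℤ) → Subset n
positives z = tabulate (λ j → does (z j ℤ.≟ 1ℤ))

signed-positive : ∀ {x} → IsSign x → signed (does (x ℤ.≟ 1ℤ)) ≡ x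
signed-positive (inj₁ refl) = refl
signed-positive (inj₂ refl) = refl

correlation-positives : ∀ {n} (z : Fin n → ℤ) → (∀ j → IsSign (z j)) → (q : Subset n) →
                        correlation (positives z) q ≡ ∑[ j < n ] (z j * signs q j)
correlation-positives z z±1 q = sum-cong-≗ (λ j →
  cong (_* signs q j) (trans (cong signed (VecP.lookup∘tabulate _ j)) (signed-positive (z±1 j))))

frankl-independent : ∀ {n k} (s : ℤ) (A : Subset n) (v w : Vertex n k) →
                     InFrankl s A v → InFrankl s A w → ¬ Adjacent s v w
frankl-independent s A (p , _) (q , _) v∈A w∈A p∩q<s = ℤP.<-irrefl refl (begin-strict
  (a + s) + (a + s)          ≤⟨ ℤP.+-mono-≤ (double ∣ p ∩ A ∣ₛ v∈A) (double ∣ q ∩ A ∣ₛ w∈A) ⟩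
  (x + x) + (y + y)          ≡⟨ interchange x y ⟩
  (x + y) + (x + y)          ≤⟨ ℤP.+-mono-≤ x+y≤i+a x+y≤i+a ⟩
  (i + a) + (i + a)          <⟨ ℤP.+-mono-< (ℤP.+-monoˡ-< a p∩q<s) (ℤP.+-monoˡ-< a p∩q<s) ⟩
  (s + a) + (s + a)          ≡⟨ cong₂ _+_ (ℤP.+-comm s a) (ℤP.+-comm s a) ⟩
  (a + s) + (a + s)          ∎)
  where
  open ℤP.≤-Reasoning
  a = + ∣ A ∣ₛ
  x = + ∣ p ∩ A ∣ₛ
  y = + ∣ q ∩ A ∣ₛ
  i = + ∣ p ∩ q ∣ₛ
  double : ∀ z → a + s ≤ + (2 ℕ.* z) → a + s ≤ + z + + z
  double z = subst (a + s ≤_) (+[2*m]≡+m++m z)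
  x+y≤i+a : x + y ≤ i + a
  x+y≤i+a = ∣p∩r∣+∣q∩r∣≤∣p∩q∣+∣r∣ p q A
  interchange : ∀ x y → (x + x) + (y + y) ≡ (x + y) + (x + y)
  interchange = solve-∀

frankl-of-correlation : ∀ {n k} (t s : ℤ) → + (2 ℕ.* k) + + 2 * t ≡ + n →
  (A : Subset n) (v : Vertex n k) → + 2 * (s + t) ≤ correlation A (proj₁ v) → InFrankl s A v
frankl-of-correlation {n} {k} t s 2k+2t≡n A (q , ∣q∣≡k) 2[s+t]≤C =
  subst (a + s ≤_) (sym (ℤP.pos-* 2 ∣ q ∩ A ∣ₛ))
    (ℤP.*-cancelˡ-≤-pos (a + s) (+ 2 * x) (+ 2) (+-cancelʳ-≤ (+ 2 * t + + 2 * k′) doubled))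
  where
  open ℤP.≤-Reasoning
  a = + ∣ A ∣ₛ
  x = + ∣ q ∩ A ∣ₛ
  k′ = + k
  C = correlation A q
  regroupˡ : ∀ a s t k → + 2 * (a + s) + (+ 2 * t + + 2 * k) ≡ + 2 * (s + t) + (+ 2 * a + + 2 * k)
  regroupˡ = solve-∀
  regroupʳ : ∀ x t k → + 4 * x + (+ 2 * k + + 2 * t) ≡ + 2 * (+ 2 * x) + (+ 2 * t + + 2 * k)
  regroupʳ = solve-∀
  doubled : + 2 * (a + s) + (+ 2 * t + + 2 * k′) ≤ + 2 * (+ 2 * x) + (+ 2 * t + + 2 * k′)
  doubled = begin
    + 2 * (a + s) + (+ 2 * t + + 2 * k′)  ≡⟨ regroupˡ a s t k′ ⟩
    + 2 * (s + t) + (+ 2 * a + + 2 * k′)  ≤⟨ ℤP.+-monoˡ-≤ (+ 2 * a + + 2 * k′) 2[s+t]≤C ⟩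
    C + (+ 2 * a + + 2 * k′)              ≡⟨ cong (λ z → C + (+ 2 * a + + 2 * + z)) (sym ∣q∣≡k) ⟩
    C + (+ 2 * a + + 2 * + ∣ q ∣ₛ)         ≡⟨ correlation-+-cards A q ⟩
    + 4 * x + + n                         ≡⟨ cong (λ z → + 4 * x + z) (sym 2k+2t≡n) ⟩
    + 4 * x + (+ (2 ℕ.* k) + + 2 * t)     ≡⟨ cong (λ z → + 4 * x + (z + + 2 * t)) (ℤP.pos-* 2 k) ⟩
    + 4 * x + (+ 2 * k′ + + 2 * t)        ≡⟨ regroupʳ x t k′ ⟩
    + 2 * (+ 2 * x) + (+ 2 * t + + 2 * k′) ∎

χF≤-of-cover : ∀ {n k c} (s : ℤ) (A : Fin c → Subset n) →
               (∀ v → ∃ λ i → InFrankl s (A i) v) → χF≤ n k s c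
χF≤-of-cover {n} {k} {c} s A cover = colour , proper , classes
  where
  colour : Vertex n k → Fin c
  colour v = proj₁ (cover v)
  classes : ∀ i → ∃ λ B → ∀ v → colour v ≡ i → InFrankl s B v
  classes i = A i , λ v colour≡i → subst (λ j → InFrankl s (A j) v) colour≡i (proj₂ (cover v))
  proper : ∀ v w → Adjacent s v w → colour v ≢ colour w
  proper v w adjacent same =
    frankl-independent s (A (colour w)) v w (proj₂ (classes (colour w)) v same) (proj₂ (cover w)) adjacent

m⊓n≡o∧o<n⇒m≡o : ∀ {m n o} → m ℕ.⊓ n ≡ o → o ℕ.< n → m ≡ o
m⊓n≡o∧o<n⇒m≡o {m} {n} m⊓n≡o o<n with ℕP.≤-total m n
... | inj₁ m≤n = trans (sym (ℕP.m≤n⇒m⊓n≡m m≤n)) m⊓n≡o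
... | inj₂ n≤m = ⊥-elim (ℕP.<⇒≢ o<n (trans (sym m⊓n≡o) (ℕP.m≥n⇒m⊓n≡n n≤m)))

module Clamp {m n} (m<n : m ℕ.< n) where

  clamp : Fin n → Fin (suc m)
  clamp j = Fin.fromℕ< (ℕ.s≤s (ℕP.m⊓n≤n (toℕ j) m))

  embed : Fin m → Fin n
  embed c = Fin.inject≤ c (ℕP.<⇒≤ m<n)

  toℕ-clamp : ∀ j → toℕ (clamp j) ≡ toℕ j ℕ.⊓ m
  toℕ-clamp j = FinP.toℕ-fromℕ< _

  clamp-embed : ∀ c → clamp (embed c) ≡ Fin.inject₁ c
  clamp-embed c = FinP.toℕ-injective (begin
    toℕ (clamp (embed c))    ≡⟨ toℕ-clamp (embed c) ⟩
    toℕ (embed c) ℕ.⊓ m      ≡⟨ cong (ℕ._⊓ m) (FinP.toℕ-inject≤ c _) ⟩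
    toℕ c ℕ.⊓ m              ≡⟨ ℕP.m≤n⇒m⊓n≡m (ℕP.<⇒≤ (FinP.toℕ<n c)) ⟩
    toℕ c                    ≡⟨ sym (FinP.toℕ-inject₁ c) ⟩
    toℕ (Fin.inject₁ c)      ∎)
    where open ≡-Reasoning

  clamp≡inject₁⇒embed≡ : ∀ c j → clamp j ≡ Fin.inject₁ c → embed c ≡ j
  clamp≡inject₁⇒embed≡ c j clamp≡ = FinP.toℕ-injective (trans (FinP.toℕ-inject≤ c _) (sym
    (m⊓n≡o∧o<n⇒m≡o (trans (sym (toℕ-clamp j)) (trans (cong toℕ clamp≡) (FinP.toℕ-inject₁ c))) (FinP.toℕ<n c))))

  ∑-fibreSum-clamp² : ∀ y → (∀ j → IsSign (y j)) →
                      + m ≤ ∑[ b < suc m ] (fibreSum clamp y b * fibreSum clamp y b)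
  ∑-fibreSum-clamp² y y±1 = begin
    + m                         ≡⟨ sym (trans (∑-const m 1ℤ) (ℤP.*-identityʳ (+ m))) ⟩
    ∑[ c < m ] 1ℤ               ≡⟨ sum-cong-≗ (λ c → sym (square-below c)) ⟩
    ∑[ c < m ] Y²-init c        ≡⟨ sym (ℤP.+-identityʳ _) ⟩
    sum Y²-init + 0ℤ            ≤⟨ ℤP.+-monoʳ-≤ (sum Y²-init) (0≤i*i (Y (Fin.fromℕ m))) ⟩
    sum Y²-init + Y²-last       ≡⟨ sym (sum-init-last (λ b → Y b * Y b)) ⟩
    ∑[ b < suc m ] (Y b * Y b)  ∎
    where
    open ℤP.≤-Reasoning
    Y : Fin (suc m) → ℤ
    Y = fibreSum clamp y
    Y²-init : Fin m → ℤ
    Y²-init c = Y (Fin.inject₁ c) * Y (Fin.inject₁ c)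
    Y²-last : ℤ
    Y²-last = Y (Fin.fromℕ m) * Y (Fin.fromℕ m)
    square-below : ∀ c → Y²-init c ≡ 1ℤ
    square-below c = trans (cong (λ z → z * z)
      (fibreSum-singleton clamp (clamp-embed c) (clamp≡inject₁⇒embed≡ c) y))
      (IsSign⇒i*i≡1 (y±1 (embed c)))

σ : Fin 2 → ℤ
σ zero       = 1ℤ
σ (suc zero) = -1ℤ

σ-IsSign : ∀ e → IsSign (σ e)
σ-IsSign zero       = inj₁ refl
σ-IsSign (suc zero) = inj₂ refl

module HadamardCover {m n} (m<n : m ℕ.< n) {H : Fin (suc m) → Fin (suc m) → ℤ}
                     (isH : IsHadamard (suc m) H) where

  open Clamp m<n

  frankl-family : Fin 2 → Fin (suc m) → Subset n
  frankl-family e l = positives (λ j → σ e * H (clamp j) l)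

  correlation-frankl-family : ∀ e l q →
    correlation (frankl-family e l) q ≡ σ e * (H ᵀ* fibreSum clamp (signs q)) l
  correlation-frankl-family e l q = begin
    correlation (frankl-family e l) q
      ≡⟨ correlation-positives _ (λ j → IsSign-* (σ-IsSign e) (proj₁ isH (clamp j) l)) q ⟩
    ∑[ j < n ] (σ e * H (clamp j) l * signs q j)
      ≡⟨ sum-cong-≗ (λ j → ℤP.*-assoc (σ e) (H (clamp j) l) (signs q j)) ⟩
    ∑[ j < n ] (σ e * (H (clamp j) l * signs q j))
      ≡⟨ sym (*-distribˡ-sum (σ e) (λ j → H (clamp j) l * signs q j)) ⟩
    σ e * ∑[ j < n ] (H (clamp j) l * signs q j)
      ≡⟨ cong (σ e *_) (sym (∑-*-fibreSum clamp (λ b → H b l) (signs q))) ⟩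
    σ e * (H ᵀ* fibreSum clamp (signs q)) l ∎
    where open ≡-Reasoning

  large-correlation : ∀ c → c * c ≤ + m → ∀ q →
                      ∃ λ e → ∃ λ l → c ≤ correlation (frankl-family e l) q
  large-correlation c c²≤m q = transfer (choose (averaging (λ l → P l * P l) (c * c) m*c²≤∑P²))
    where
    Y P : Fin (suc m) → ℤ
    Y = fibreSum clamp (signs q)
    P = H ᵀ* Y
    m*c²≤∑P² : + suc m * (c * c) ≤ ∑[ l < suc m ] (P l * P l)
    m*c²≤∑P² = ℤP.≤-trans
      (ℤP.*-monoˡ-≤-nonNeg (+ suc m)
        (ℤP.≤-trans c²≤m (∑-fibreSum-clamp² (signs q) (λ j → signed-IsSign (lookup q j)))))
      (ℤP.≤-reflexive (sym (parseval isH Y)))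
    choose : (∃ λ l → c * c ≤ P l * P l) → ∃ λ e → ∃ λ l → c ≤ σ e * P l
    choose (l , c²≤Pl²) = Sum.[ (λ c≤Pl  → zero , l , subst (c ≤_) (sym (ℤP.*-identityˡ (P l))) c≤Pl)
                              , (λ c≤-Pl → suc zero , l , subst (c ≤_) (sym (ℤP.-1*i≡-i (P l))) c≤-Pl)
                              ] (i*i≤j*j⇒i≤j⊎i≤-j c (P l) c²≤Pl²)
    transfer : (∃ λ e → ∃ λ l → c ≤ σ e * P l) → ∃ λ e → ∃ λ l → c ≤ correlation (frankl-family e l) q
    transfer (e , l , c≤σP) = e , l , subst (c ≤_) (sym (correlation-frankl-family e l q)) c≤σP

  frankl-colouring : ∀ {k} (t s : ℤ) → + (2 ℕ.* k) + + 2 * t ≡ + n →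
                     + 2 * (s + t) * (+ 2 * (s + t)) ≤ + m → χF≤ n k s (2 ℕ.* suc m)
  frankl-colouring t s 2k+2t≡n c*c≤m =
    χF≤-of-cover s (λ i → uncurry frankl-family (Fin.remQuot (suc m) i)) cover
    where
    cover : ∀ v → ∃ λ i → InFrankl s (uncurry frankl-family (Fin.remQuot (suc m) i)) v
    cover v = colour (large-correlation (+ 2 * (s + t)) c*c≤m (proj₁ v))
      where
      colour : (∃ λ e → ∃ λ l → + 2 * (s + t) ≤ correlation (frankl-family e l) (proj₁ v)) →
               ∃ λ i → InFrankl s (uncurry frankl-family (Fin.remQuot (suc m) i)) v
      colour (e , l , c≤C) = Fin.combine e l ,
        subst (λ el → InFrankl s (uncurry frankl-family el) v) (sym (FinP.remQuot-combine e l))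
              (frankl-of-correlation t s 2k+2t≡n (frankl-family e l) v c≤C)

theorem6 : (n : ℕ) (t s : ℤ) (k : ℕ) → + (2 ℕ.* k) + + 2 * t ≡ + n →
    (m : ℕ) → m ℕ.≤ n → + 4 * ((s + t) * (s + t)) < + m → HadamardExists m →
    χF≤ n k s (2 ℕ.* m)
theorem6 n t s k 2k+2t≡n zero _ Q<0 _ =
  ⊥-elim (ℤP.<⇒≱ Q<0 (subst (0ℤ ≤_) (sym (4[i*i]≡[2i]*[2i] (s + t))) (0≤i*i (+ 2 * (s + t)))))
theorem6 n t s k 2k+2t≡n (suc m) m<n Q<1+m (H , isH) =
  HadamardCover.frankl-colouring m<n isH t s 2k+2t≡n
    (subst (_≤ + m) (4[i*i]≡[2i]*[2i] (s + t)) (ℤP.i<j⇒i≤pred[j] Q<1+m))
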